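{- Let $m\equiv 3\pmod 4$ and let $G$ be the $G_{3,m}$ grid. Let $j,k,l$ be positive integers with $j+3\le k$, $k+3\le l$ and $l+3\le m$, and let $M$ be an induced matching of $G$ containing the six edges $u_1v_t\,u_2v_t$ for $t\in\{j,\,j+3,\,k,\,k+3,\,l,\,l+3\}$. Then $M$ is not a maximum induced matching of $G$.
   Context: A grid $G_{n,m}$ is the Cartesian product $P_n\square P_m$ of paths with $V(P_n)=\{u_1,\dots,u_n\}$ and $V(P_m)=\{v_1,\dots,v_m\}$; its vertices are written $u_av_b$ ($a$ the row index in $\{1,\dots,n\}$, $b$ the column index in $\{1,\dots,m\}$), and $u_av_b$ is adjacent to $u_{a\pm1}v_b$ and $u_av_{b\pm1}$ when these exist. An induced matching is a set $M$ of edges such that no endpoint of one edge of $M$ is adjacent to (or equal to) an endpoint of another edge of $M$. A maximum induced matching is an induced matching of largest possible size. -}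

module Defs where

open import Data.Nat using (ℕ; suc; _+_; _≤_; _<_)
open import Data.Product using (_×_; _,_; proj₁; proj₂)
open import Data.Sum using (_⊎_)
open import Data.Fin using (Fin; _≟_)
open import Data.List using (List; length; lookup)
open import Data.List.Membership.Propositional using (_∈_)
open import Relation.Binary.PropositionalEquality using (_≡_)
open import Relation.Nullary using (¬_)

-- A vertex u_a v_b of G_{n,m} is represented by the pair (a , b),
-- with 1-based row index a and column index b.
Vertex : Set
Vertex = ℕ × ℕ

InGrid : ℕ → ℕ → Vertex → Set
InGrid n m (a , b) = (1 ≤ a × a ≤ n) × (1 ≤ b × b ≤ m)

Adj : Vertex → Vertex → Set
Adj (a , b) (a' , b') =
  ((suc a ≡ a' ⊎ suc a' ≡ a) × b ≡ b') ⊎ (a ≡ a' × (suc b ≡ b' ⊎ suc b' ≡ b))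

Edge : Set
Edge = Vertex × Vertex

IsEdge : ℕ → ℕ → Edge → Set
IsEdge n m (x , y) = InGrid n m x × InGrid n m y × Adj x y

Touch : Vertex → Vertex → Set
Touch x y = x ≡ y ⊎ Adj x y

Close : Edge → Edge → Set
Close (x , y) (x' , y') =
  Touch x x' ⊎ Touch x y' ⊎ Touch y x' ⊎ Touch y y'

-- An induced matching of G_{n,m}, given as a list of edges: every entry is
-- an edge of the grid, and any two entries at distinct positions are not
-- close (in particular the list has no repeated edge, so its length is the
-- size of the matching).
IsInducedMatching : ℕ → ℕ → List Edge → Set
IsInducedMatching n m M =
  (∀ i → IsEdge n m (lookup M i)) ×
  (∀ i j → ¬ (i ≡ j) → ¬ Close (lookup M i) (lookup M j))

IsMaximumInducedMatching : ℕ → ℕ → List Edge → Set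
IsMaximumInducedMatching n m M =
  IsInducedMatching n m M ×
  (∀ M' → IsInducedMatching n m M' → length M' ≤ length M)

vEdge12 : ℕ → Edge
vEdge12 t = ((1 , t) , (2 , t))

HasEdge : List Edge → Vertex → Vertex → Set
HasEdge M x y = (x , y) ∈ M ⊎ (y , x) ∈ M

HasV12 : List Edge → ℕ → Set
HasV12 M t = HasEdge M (1 , t) (2 , t)

-- Let column c record which of its three vertices M covers.  As M is a matching, 2|M| is at
-- most the number of covered vertices, and as M is induced, every covered vertex has exactly
-- one covered neighbour: a condition on any three consecutive columns.  A potential on pairs of
-- adjacent columns, checked on all 8³ column triples, telescopes along the columns: n columns
-- running from column 1, or from a pinned column (rows 1 and 2 covered by a vertical edge of M),
-- up to just before a pinned column cover at most 3n/2 vertices, and by symmetry so do the n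
-- columns after a pinned column up to column m.  If t and t + 3 are pinned, the columns t, t + 1
-- and t + 2 cover at most 4 < 9/2 vertices.  Splitting 1 … m at the six pinned columns thus
-- gains 1/2 at each pinned pair and loses 1/2 at the last pinned column, so 4|M| + 2 ≤ 3m and
-- |M| ≤ 3q + 1 for m = 4q + 3, whereas a staggered matching has 3q + 2 edges.
module Submission where

open import Data.Bool using (Bool; true; false; T; _∧_)
open import Data.Bool.Properties using (T-∧)
open import Data.Empty using (⊥-elim)
open import Data.Fin using () renaming (zero to fzero; suc to fsuc)
open import Data.List using (List; []; _∷_; _++_; length; lookup; map; applyUpTo; cartesianProduct)
open import Data.List.Membership.Propositional using (_∈_)
open import Data.List.Membership.Propositional.Properties using (∈-lookup; ∈-cartesianProduct⁺)
open import Data.List.Properties using (tabulate-lookup; length-++; length-applyUpTo)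
open import Data.List.Relation.Unary.All as All using (All; []; _∷_)
import Data.List.Relation.Unary.All.Properties as All
open import Data.List.Relation.Unary.AllPairs as AllPairs using (AllPairs; []; _∷_)
import Data.List.Relation.Unary.AllPairs.Properties as AllPairs
open import Data.List.Relation.Unary.Any using (here; there)
open import Data.List.Relation.Unary.Unique.Propositional using (Unique)
open import Data.Nat
  using (ℕ; zero; suc; _+_; _*_; _≤_; _<_; z≤n; s≤s; _<ᵇ_; _≡ᵇ_; _≟_; _≤?_; _%_; _/_)
open import Data.Nat.DivMod using ([m+kn]%n≡m%n; m≡m%n+[m/n]*n)
open import Data.Nat.ListAction using (sum)
open import Data.Nat.Properties
open import Algebra.Properties.CommutativeSemigroup +-commutativeSemigroup
  using (interchange; x∙yz≈y∙xz; xy∙z≈xz∙y; xy∙z≈x∙zy)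
open import Data.Nat.Tactic.RingSolver using (solve-∀)
open import Data.Product using (_×_; _,_; proj₁; proj₂; uncurry; ∃-syntax)
open import Data.Product.Properties using (≡-dec)
open import Data.Sum using (_⊎_; inj₁; inj₂)
open import Defs
open import Function using (_∘_)
open import Function.Bundles using (Equivalence)
open import Relation.Binary.PropositionalEquality
  using (_≡_; _≢_; refl; sym; trans; cong; cong₂; subst; module ≡-Reasoning)
open import Relation.Nullary using (¬_; Dec; yes; no; does; T?; _×-dec_; _→-dec_)
open import Relation.Nullary.Decidable using (True; toWitness)

Apart : Edge → Edge → Set
Apart e f = ¬ Close e f

Adj-sym : ∀ {x y} → Adj x y → Adj y x
Adj-sym (inj₁ (inj₁ up , same))    = inj₁ (inj₂ up , sym same)
Adj-sym (inj₁ (inj₂ down , same))  = inj₁ (inj₁ down , sym same)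
Adj-sym (inj₂ (same , inj₁ right)) = inj₂ (sym same , inj₂ right)
Adj-sym (inj₂ (same , inj₂ left))  = inj₂ (sym same , inj₁ left)

Adj-irrefl : ∀ {x} → ¬ Adj x x
Adj-irrefl (inj₁ (inj₁ () , _))
Adj-irrefl (inj₁ (inj₂ () , _))
Adj-irrefl (inj₂ (_ , inj₁ ()))
Adj-irrefl (inj₂ (_ , inj₂ ()))

Touch-sym : ∀ {x y} → Touch x y → Touch y x
Touch-sym (inj₁ x≡y) = inj₁ (sym x≡y)
Touch-sym (inj₂ x~y) = inj₂ (Adj-sym x~y)

Close-sym : ∀ {e f} → Close e f → Close f e
Close-sym (inj₁ t)               = inj₁ (Touch-sym t)
Close-sym (inj₂ (inj₁ t))        = inj₂ (inj₂ (inj₁ (Touch-sym t)))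
Close-sym (inj₂ (inj₂ (inj₁ t))) = inj₂ (inj₁ (Touch-sym t))
Close-sym (inj₂ (inj₂ (inj₂ t))) = inj₂ (inj₂ (inj₂ (Touch-sym t)))

Touch-column : ∀ {a b a′ b′} → Touch (a , b) (a′ , b′) → b′ ≤ suc b
Touch-column (inj₁ refl)                   = n≤1+n _
Touch-column (inj₂ (inj₁ (_ , refl)))      = n≤1+n _
Touch-column (inj₂ (inj₂ (_ , inj₁ refl))) = ≤-refl
Touch-column (inj₂ (inj₂ (_ , inj₂ refl))) = ≤-trans (n≤1+n _) (n≤1+n _)

Touch-row : ∀ {a b a′ b′} → Touch (a , b) (a′ , b′) → a′ ≤ suc a
Touch-row (inj₁ refl)                   = n≤1+n _
Touch-row (inj₂ (inj₁ (inj₁ refl , _))) = ≤-refl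
Touch-row (inj₂ (inj₁ (inj₂ refl , _))) = ≤-trans (n≤1+n _) (n≤1+n _)
Touch-row (inj₂ (inj₂ (refl , _)))      = n≤1+n _

Touch-across-rows : ∀ {a b a′ b′} → a ≢ a′ → Touch (a , b) (a′ , b′) → b ≡ b′
Touch-across-rows a≢a′ (inj₁ refl)              = ⊥-elim (a≢a′ refl)
Touch-across-rows a≢a′ (inj₂ (inj₁ (_ , b≡b′))) = b≡b′
Touch-across-rows a≢a′ (inj₂ (inj₂ (a≡a′ , _))) = ⊥-elim (a≢a′ a≡a′)

Endpoint : Vertex → Edge → Set
Endpoint v (x , y) = v ≡ x ⊎ v ≡ y

Close-endpoints : ∀ {v w e f} → Endpoint v e → Endpoint w f → Touch v w → Close e f
Close-endpoints (inj₁ refl) (inj₁ refl) t = inj₁ t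
Close-endpoints (inj₁ refl) (inj₂ refl) t = inj₂ (inj₁ t)
Close-endpoints (inj₂ refl) (inj₁ refl) t = inj₂ (inj₂ (inj₁ t))
Close-endpoints (inj₂ refl) (inj₂ refl) t = inj₂ (inj₂ (inj₂ t))

Apart-intro : ∀ {e f} → (∀ {v w} → Endpoint v e → Endpoint w f → ¬ Touch v w) → Apart e f
Apart-intro far (inj₁ t)               = far (inj₁ refl) (inj₁ refl) t
Apart-intro far (inj₂ (inj₁ t))        = far (inj₁ refl) (inj₂ refl) t
Apart-intro far (inj₂ (inj₂ (inj₁ t))) = far (inj₂ refl) (inj₁ refl) t
Apart-intro far (inj₂ (inj₂ (inj₂ t))) = far (inj₂ refl) (inj₂ refl) t

other-endpoint : ∀ {v e} → Endpoint v e → Adj (proj₁ e) (proj₂ e) → ∃[ w ] Endpoint w e × Adj v w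
other-endpoint (inj₁ refl) x~y = _ , inj₂ refl , x~y
other-endpoint (inj₂ refl) x~y = _ , inj₁ refl , Adj-sym x~y

other-endpoint-unique : ∀ {v z w e} → Endpoint v e → Endpoint z e → Endpoint w e →
                        z ≢ v → w ≢ v → z ≡ w
other-endpoint-unique (inj₁ refl) (inj₁ refl) _           z≢v _   = ⊥-elim (z≢v refl)
other-endpoint-unique (inj₁ refl) (inj₂ refl) (inj₁ refl) _   w≢v = ⊥-elim (w≢v refl)
other-endpoint-unique (inj₁ refl) (inj₂ refl) (inj₂ refl) _   _   = refl
other-endpoint-unique (inj₂ refl) (inj₂ refl) _           z≢v _   = ⊥-elim (z≢v refl)
other-endpoint-unique (inj₂ refl) (inj₁ refl) (inj₁ refl) _   _   = refl
other-endpoint-unique (inj₂ refl) (inj₁ refl) (inj₂ refl) _   w≢v = ⊥-elim (w≢v refl)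

-- Induced matchings

Close⇒≡ : ∀ {M e f} → AllPairs Apart M → e ∈ M → f ∈ M → Close e f → e ≡ f
Close⇒≡ (_ ∷ _)     (here refl) (here refl) _ = refl
Close⇒≡ (e#M ∷ _)   (here refl) (there f∈M) c = ⊥-elim (All.lookup e#M f∈M c)
Close⇒≡ (f#M ∷ _)   (there e∈M) (here refl) c = ⊥-elim (All.lookup f#M e∈M (Close-sym c))
Close⇒≡ (_ ∷ apart) (there e∈M) (there f∈M) c = Close⇒≡ apart e∈M f∈M c

induced⇒edges : ∀ {n m M} → IsInducedMatching n m M → All (IsEdge n m) M
induced⇒edges {M = M} (edges , _) = subst (All (IsEdge _ _)) (tabulate-lookup M) (All.tabulate⁺ edges)

induced⇒apart : ∀ {n m M} → IsInducedMatching n m M → AllPairs Apart M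
induced⇒apart {M = M} (_ , apart) =
  subst (AllPairs Apart) (tabulate-lookup M) (AllPairs.tabulate⁺ (apart _ _))

apart⇒lookup : ∀ {M} → AllPairs Apart M → ∀ i j → i ≢ j → Apart (lookup M i) (lookup M j)
apart⇒lookup (_ ∷ _)     fzero    fzero    i≢j = ⊥-elim (i≢j refl)
apart⇒lookup (e#M ∷ _)   fzero    (fsuc j) _   = All.lookup e#M (∈-lookup j)
apart⇒lookup (e#M ∷ _)   (fsuc i) fzero    _   = All.lookup e#M (∈-lookup i) ∘ Close-sym
apart⇒lookup (_ ∷ apart) (fsuc i) (fsuc j) i≢j = apart⇒lookup apart i j (i≢j ∘ cong fsuc)

edges+apart⇒induced : ∀ {n m M} → All (IsEdge n m) M → AllPairs Apart M → IsInducedMatching n m M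
edges+apart⇒induced edges apart = (λ i → All.lookup edges (∈-lookup i)) , apart⇒lookup apart

bit : Bool → ℕ
bit false = 0
bit true  = 1

_≟ᵥ_ : (v w : Vertex) → Dec (v ≡ w)
_≟ᵥ_ = ≡-dec _≟_ _≟_

δ : Vertex → Vertex → ℕ
δ x v = bit (does (x ≟ᵥ v))

degree : List Edge → Vertex → ℕ
degree []            v = 0
degree ((x , y) ∷ M) v = δ x v + δ y v + degree M v

covered : List Edge → Vertex → Bool
covered M v = 0 <ᵇ degree M v

covered⇒endpoint : ∀ {M v} → T (covered M v) → ∃[ e ] e ∈ M × Endpoint v e
covered⇒endpoint {(x , y) ∷ M} {v} cov with x ≟ᵥ v | y ≟ᵥ v
... | yes refl | _        = _ , here refl , inj₁ refl
... | no _     | yes refl = _ , here refl , inj₂ refl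
... | no _     | no _     with covered⇒endpoint {M} cov
...   | e , e∈M , v∈e = e , there e∈M , v∈e

endpoint⇒degree : ∀ {M v e} → e ∈ M → Endpoint v e → 1 ≤ degree M v
endpoint⇒degree (here {x = x , y} refl) (inj₁ refl) with x ≟ᵥ x
... | yes _  = s≤s z≤n
... | no x≢x = ⊥-elim (x≢x refl)
endpoint⇒degree {_ ∷ M} (here {x = x , y} refl) (inj₂ refl) with y ≟ᵥ y
... | yes _  = ≤-trans (m≤n+m 1 (δ x y)) (m≤m+n _ (degree M y))
... | no y≢y = ⊥-elim (y≢y refl)
endpoint⇒degree {v = v} (there {x = x , y} e∈M) v∈e =
  ≤-trans (endpoint⇒degree e∈M v∈e) (m≤n+m _ (δ x v + δ y v))

endpoint⇒covered : ∀ {M v e} → e ∈ M → Endpoint v e → T (covered M v)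
endpoint⇒covered e∈M v∈e = <⇒<ᵇ (endpoint⇒degree e∈M v∈e)

neighbours : ℕ → ℕ → List Vertex
neighbours r c = (suc r , c) ∷ (suc r , suc (suc c)) ∷ (r , suc c) ∷ (suc (suc r) , suc c) ∷ []

neighbours-unique : ∀ r c → Unique (neighbours r c)
neighbours-unique r c =
  ((λ ()) ∷ (λ ()) ∷ (λ ()) ∷ []) ∷ ((λ ()) ∷ (λ ()) ∷ []) ∷ ((λ ()) ∷ []) ∷ [] ∷ []

Adj⇒∈neighbours : ∀ {r c z} → Adj (suc r , suc c) z → z ∈ neighbours r c
Adj⇒∈neighbours (inj₂ (refl , inj₂ refl)) = here refl
Adj⇒∈neighbours (inj₂ (refl , inj₁ refl)) = there (here refl)
Adj⇒∈neighbours (inj₁ (inj₂ refl , refl)) = there (there (here refl))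
Adj⇒∈neighbours (inj₁ (inj₁ refl , refl)) = there (there (there (here refl)))

∈neighbours⇒Adj : ∀ {r c z} → z ∈ neighbours r c → Adj (suc r , suc c) z
∈neighbours⇒Adj (here refl)                         = inj₂ (refl , inj₂ refl)
∈neighbours⇒Adj (there (here refl))                 = inj₂ (refl , inj₁ refl)
∈neighbours⇒Adj (there (there (here refl)))         = inj₁ (inj₂ refl , refl)
∈neighbours⇒Adj (there (there (there (here refl)))) = inj₁ (inj₁ refl , refl)

sum-bits-≡0 : ∀ {A : Set} (p : A → Bool) {xs} → (∀ {z} → z ∈ xs → ¬ T (p z)) →
              sum (map (bit ∘ p) xs) ≡ 0
sum-bits-≡0 p {[]}     _    = refl
sum-bits-≡0 p {x ∷ xs} none with p x in px
... | true  = ⊥-elim (none (here refl) (subst T (sym px) _))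
... | false = sum-bits-≡0 p (none ∘ there)

sum-bits-≡1 : ∀ {A : Set} (p : A → Bool) {w xs} → Unique xs → w ∈ xs → T (p w) →
              (∀ {z} → z ∈ xs → T (p z) → z ≡ w) → sum (map (bit ∘ p) xs) ≡ 1
sum-bits-≡1 p {xs = x ∷ xs} (x∉xs ∷ _) _ _ only with p x in px
... | true  = cong suc (sum-bits-≡0 p λ z∈xs pz →
                All.lookup x∉xs z∈xs (trans (only (here refl) (subst T (sym px) _))
                                            (sym (only (there z∈xs) pz))))
sum-bits-≡1 p (_ ∷ unique) (here refl)  pw only | false = ⊥-elim (subst T px pw)
sum-bits-≡1 p (_ ∷ unique) (there w∈xs) pw only | false = sum-bits-≡1 p unique w∈xs pw (only ∘ there)

module Matching {n m M} (edges : All (IsEdge n m) M) (apart : AllPairs Apart M) where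

  adjacent : ∀ {e} → e ∈ M → Adj (proj₁ e) (proj₂ e)
  adjacent e∈M = proj₂ (proj₂ (All.lookup edges e∈M))

  covered⇒InGrid : ∀ {v} → T (covered M v) → InGrid n m v
  covered⇒InGrid cov with covered⇒endpoint cov
  ... | e , e∈M , inj₁ refl = proj₁ (All.lookup edges e∈M)
  ... | e , e∈M , inj₂ refl = proj₁ (proj₂ (All.lookup edges e∈M))

  apart⇒degree≡0 : ∀ {e v N} → All (Apart e) N → Endpoint v e → degree N v ≡ 0
  apart⇒degree≡0 {_} {v} {N} e#N v∈e with degree N v in deg
  ... | zero  = refl
  ... | suc _ with covered⇒endpoint {N} {v} (subst (T ∘ (0 <ᵇ_)) (sym deg) _)
  ...   | f , f∈N , v∈f = ⊥-elim (All.lookup e#N f∈N (Close-endpoints v∈e v∈f (inj₁ refl)))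

  degree≤1 : ∀ v → degree M v ≤ 1
  degree≤1 = go edges apart
    where
    go : ∀ {N} → All (IsEdge n m) N → AllPairs Apart N → ∀ v → degree N v ≤ 1
    go {[]}          _                     _            v = z≤n
    go {(x , y) ∷ N} ((_ , _ , x~y) ∷ es) (e#N ∷ ap) v with x ≟ᵥ v | y ≟ᵥ v
    ... | yes refl | yes refl = ⊥-elim (Adj-irrefl x~y)
    ... | yes refl | no _     = s≤s (≤-reflexive (apart⇒degree≡0 e#N (inj₁ refl)))
    ... | no _     | yes refl = s≤s (≤-reflexive (apart⇒degree≡0 e#N (inj₂ refl)))
    ... | no _     | no _     = go es ap v

  -- A covered neighbour z of v lies on an edge close to the edge e covering v, hence on e itself.
  unique-partner : ∀ {v} → T (covered M v) →
                   ∃[ w ] Adj v w × T (covered M w) × (∀ {z} → Adj v z → T (covered M z) → z ≡ w)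
  unique-partner {v} cov with covered⇒endpoint cov
  ... | e , e∈M , v∈e with other-endpoint v∈e (adjacent e∈M)
  ... | w , w∈e , v~w = w , v~w , endpoint⇒covered e∈M w∈e , only
    where
    ≢v : ∀ {z} → Adj v z → z ≢ v
    ≢v v~z refl = Adj-irrefl v~z
    only : ∀ {z} → Adj v z → T (covered M z) → z ≡ w
    only v~z cov-z with covered⇒endpoint cov-z
    ... | f , f∈M , z∈f with Close⇒≡ apart e∈M f∈M (Close-endpoints v∈e z∈f (inj₂ v~z))
    ... | refl = other-endpoint-unique v∈e z∈f w∈e (≢v v~z) (≢v v~w)

  one-covered-neighbour : ∀ {r c} → T (covered M (suc r , suc c)) →
                          sum (map (bit ∘ covered M) (neighbours r c)) ≡ 1
  one-covered-neighbour {r} {c} cov with unique-partner cov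
  ... | w , v~w , cov-w , only =
    sum-bits-≡1 (covered M) (neighbours-unique r c) (Adj⇒∈neighbours v~w) cov-w (only ∘ ∈neighbours⇒Adj)

-- Columns

Column : Set
Column = Bool × Bool × Bool

empty : Column
empty = false , false , false

size : Column → ℕ
size (b₁ , b₂ , b₃) = bit b₁ + bit b₂ + bit b₃

pinned : Column → Bool
pinned (b₁ , b₂ , _) = b₁ ∧ b₂

column : List Edge → ℕ → Column
column M c = covered M (1 , c) , covered M (2 , c) , covered M (3 , c)

ExactlyOne : List Bool → Set
ExactlyOne bs = sum (map bit bs) ≡ 1

-- Each covered vertex of the middle column has exactly one covered neighbour, listed as left,
-- right, above, below; false stands for the missing rows 0 and 4.
Consistent : Column → Column → Column → Set
Consistent (a₁ , a₂ , a₃) (b₁ , b₂ , b₃) (c₁ , c₂ , c₃) =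
  (T b₁ → ExactlyOne (a₁ ∷ c₁ ∷ false ∷ b₂ ∷ [])) ×
  (T b₂ → ExactlyOne (a₂ ∷ c₂ ∷ b₁ ∷ b₃ ∷ [])) ×
  (T b₃ → ExactlyOne (a₃ ∷ c₃ ∷ b₂ ∷ false ∷ []))

consistent? : ∀ a b c → Dec (Consistent a b c)
consistent? (a₁ , a₂ , a₃) (b₁ , b₂ , b₃) (c₁ , c₂ , c₃) =
  (T? b₁ →-dec _ ≟ 1) ×-dec (T? b₂ →-dec _ ≟ 1) ×-dec (T? b₃ →-dec _ ≟ 1)

-- The least solution of the inequalities potential-step that is at least 2 at pinned columns,
-- computed as longest paths through consistent column triples.
potential : Column → Column → ℕ
potential _                   (false , false , false) = 0
potential _                   (false , false , true ) = 1
potential _                   (true  , false , false) = 1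
potential (_ , a₂ , _)        (false , true  , false) = bit a₂
potential (_ , false , false) (false , true  , true ) = 2
potential (false , false , _) (true  , true  , false) = 2
potential (true , _ , true)   (true  , false , true ) = 1
potential _                   (true  , false , true ) = 2
potential _                   _                       = 0

columns : List Column
columns = cartesianProduct bools (cartesianProduct bools bools)
  where bools = true ∷ false ∷ []

∈-columns : ∀ a → a ∈ columns
∈-columns (b₁ , b₂ , b₃) =
  ∈-cartesianProduct⁺ (∈-bools b₁) (∈-cartesianProduct⁺ (∈-bools b₂) (∈-bools b₃))
  where
  ∈-bools : ∀ b → b ∈ true ∷ false ∷ []
  ∈-bools true  = here refl
  ∈-bools false = there (here refl)

-- The True argument is discharged by the type checker evaluating the decision on all triples.
decide : {Q : Column → Column → Column → Set} (Q? : ∀ a b c → Dec (Q a b c)) →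
         True (All.all? (λ a → All.all? (λ b → All.all? (Q? a b) columns) columns) columns) →
         ∀ a b c → Q a b c
decide Q? checked a b c =
  All.lookup (All.lookup (All.lookup (toWitness checked) (∈-columns a)) (∈-columns b)) (∈-columns c)

consistent-reverse : ∀ a b c → Consistent a b c → Consistent c b a
consistent-reverse = decide (λ a b c → consistent? a b c →-dec consistent? c b a) _

potential-step : ∀ a b c → Consistent a b c → 2 * size b + potential b c ≤ 3 + potential a b
potential-step = decide (λ a b c → consistent? a b c →-dec 2 * size b + potential b c ≤? 3 + potential a b) _

potential-pinned : ∀ a b c → Consistent a b c → T (pinned b) → potential a b ≡ 2
potential-pinned = decide (λ a b c → consistent? a b c →-dec T? (pinned b) →-dec potential a b ≟ 2) _

potential-empty : ∀ a b c → Consistent a b c → a ≡ empty → potential a b ≤ 2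
potential-empty _ b c cons refl =
  decide (λ _ b c → consistent? empty b c →-dec potential empty b ≤? 2) _ empty b c cons

size-pinned : ∀ a b c → Consistent a b c → T (pinned b) → size b ≤ 2
size-pinned = decide (λ a b c → consistent? a b c →-dec T? (pinned b) →-dec size b ≤? 2) _

size-after-pinned : ∀ a b c → Consistent a b c → T (pinned b) → size c ≤ 1
size-after-pinned = decide (λ a b c → consistent? a b c →-dec T? (pinned b) →-dec size c ≤? 1) _

sumFrom : (ℕ → ℕ) → ℕ → ℕ → ℕ
sumFrom f x zero    = 0
sumFrom f x (suc n) = f x + sumFrom f (suc x) n

sumFrom-split : ∀ f x n n′ → sumFrom f x (n + n′) ≡ sumFrom f x n + sumFrom f (x + n) n′
sumFrom-split f x zero    n′ = cong (λ y → sumFrom f y n′) (sym (+-identityʳ x))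
sumFrom-split f x (suc n) n′ = begin
  f x + sumFrom f (suc x) (n + n′)                        ≡⟨ cong (f x +_) (sumFrom-split f (suc x) n n′) ⟩
  f x + (sumFrom f (suc x) n + sumFrom f (suc x + n) n′) ≡⟨ +-assoc (f x) _ _ ⟨
  f x + sumFrom f (suc x) n + sumFrom f (suc x + n) n′   ≡⟨ cong (_ +_) (cong (λ y → sumFrom f y n′) (+-suc x n)) ⟨
  f x + sumFrom f (suc x) n + sumFrom f (x + suc n) n′   ∎
  where open ≡-Reasoning

sumFrom-0 : ∀ x n → sumFrom (λ _ → 0) x n ≡ 0
sumFrom-0 x zero    = refl
sumFrom-0 x (suc n) = sumFrom-0 (suc x) n

sumFrom-cong : ∀ {f g} → (∀ i → f i ≡ g i) → ∀ x n → sumFrom f x n ≡ sumFrom g x n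
sumFrom-cong f≡g x zero    = refl
sumFrom-cong f≡g x (suc n) = cong₂ _+_ (f≡g x) (sumFrom-cong f≡g (suc x) n)

sumFrom-mono : ∀ {f g} → (∀ i → f i ≤ g i) → ∀ x n → sumFrom f x n ≤ sumFrom g x n
sumFrom-mono f≤g x zero    = ≤-refl
sumFrom-mono f≤g x (suc n) = +-mono-≤ (f≤g x) (sumFrom-mono f≤g (suc x) n)

sumFrom-distrib-+ : ∀ f g x n → sumFrom (λ i → f i + g i) x n ≡ sumFrom f x n + sumFrom g x n
sumFrom-distrib-+ f g x zero    = refl
sumFrom-distrib-+ f g x (suc n) =
  trans (cong (f x + g x +_) (sumFrom-distrib-+ f g (suc x) n)) (interchange (f x) (g x) _ _)

sumFrom-distribˡ-* : ∀ k f x n → sumFrom (λ i → k * f i) x n ≡ k * sumFrom f x n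
sumFrom-distribˡ-* k f x zero    = sym (*-zeroʳ k)
sumFrom-distribˡ-* k f x (suc n) =
  trans (cong (k * f x +_) (sumFrom-distribˡ-* k f (suc x) n)) (sym (*-distribˡ-+ k (f x) _))

sumFrom-indicator-out : ∀ {b} x n → b < x → sumFrom (λ c → bit (b ≡ᵇ c)) x n ≡ 0
sumFrom-indicator-out x zero b<x = refl
sumFrom-indicator-out {b} x (suc n) b<x with b ≡ᵇ x in b=x
... | true  = ⊥-elim (<-irrefl (≡ᵇ⇒≡ b x (subst T (sym b=x) _)) b<x)
... | false = sumFrom-indicator-out (suc x) n (m<n⇒m<1+n b<x)

sumFrom-indicator-in : ∀ {b} x n → x ≤ b → b < x + n → sumFrom (λ c → bit (b ≡ᵇ c)) x n ≡ 1
sumFrom-indicator-in x zero x≤b b<x+0 =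
  ⊥-elim (<-irrefl refl (<-≤-trans b<x+0 (≤-trans (≤-reflexive (+-identityʳ x)) x≤b)))
sumFrom-indicator-in {b} x (suc n) x≤b b<x+1+n with b ≡ᵇ x in b=x
... | true  = cong suc (sumFrom-indicator-out (suc x) n (s≤s (≤-reflexive (≡ᵇ⇒≡ b x (subst T (sym b=x) _)))))
... | false = sumFrom-indicator-in (suc x) n (≤∧≢⇒< x≤b λ x≡b → subst T b=x (≡⇒≡ᵇ b x (sym x≡b)))
                                             (subst (b <_) (+-suc x n) b<x+1+n)

-- Φ i is the potential between positions i and suc i.
telescope : ∀ {w Φ : ℕ → ℕ} {k} → (∀ i → w (suc i) + Φ (suc i) ≤ k + Φ i) →
            ∀ x n → sumFrom w (suc x) n + Φ (x + n) ≤ n * k + Φ x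
telescope {Φ = Φ} step x zero = ≤-reflexive (cong Φ (+-identityʳ x))
telescope {w} {Φ} {k} step x (suc n) = begin
  w (suc x) + sumFrom w (suc (suc x)) n + Φ (x + suc n)   ≡⟨ cong (_ +_) (cong Φ (+-suc x n)) ⟩
  w (suc x) + sumFrom w (suc (suc x)) n + Φ (suc x + n)   ≡⟨ +-assoc (w (suc x)) _ _ ⟩
  w (suc x) + (sumFrom w (suc (suc x)) n + Φ (suc x + n)) ≤⟨ +-monoʳ-≤ (w (suc x)) (telescope step (suc x) n) ⟩
  w (suc x) + (n * k + Φ (suc x))                         ≡⟨ x∙yz≈y∙xz (w (suc x)) (n * k) _ ⟩
  n * k + (w (suc x) + Φ (suc x))                         ≤⟨ +-monoʳ-≤ (n * k) (step x) ⟩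
  n * k + (k + Φ x)                                       ≡⟨ x∙yz≈y∙xz (n * k) k (Φ x) ⟩
  k + (n * k + Φ x)                                       ≡⟨ +-assoc k (n * k) (Φ x) ⟨
  suc n * k + Φ x                                         ∎
  where open ≤-Reasoning

telescope⁻ : ∀ {w Φ : ℕ → ℕ} {k} → (∀ i → w (suc i) + Φ i ≤ k + Φ (suc i)) →
             ∀ x n → sumFrom w (suc x) n + Φ x ≤ n * k + Φ (x + n)
telescope⁻ {Φ = Φ} step x zero = ≤-reflexive (cong Φ (sym (+-identityʳ x)))
telescope⁻ {w} {Φ} {k} step x (suc n) = begin
  w (suc x) + sumFrom w (suc (suc x)) n + Φ x ≡⟨ xy∙z≈xz∙y (w (suc x)) _ (Φ x) ⟩
  w (suc x) + Φ x + sumFrom w (suc (suc x)) n ≤⟨ +-monoˡ-≤ _ (step x) ⟩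
  k + Φ (suc x) + sumFrom w (suc (suc x)) n   ≡⟨ xy∙z≈x∙zy k (Φ (suc x)) _ ⟩
  k + (sumFrom w (suc (suc x)) n + Φ (suc x)) ≤⟨ +-monoʳ-≤ k (telescope⁻ step (suc x) n) ⟩
  k + (n * k + Φ (suc x + n))                 ≡⟨ +-assoc k (n * k) _ ⟨
  suc n * k + Φ (suc x + n)                   ≡⟨ cong (_ +_) (cong Φ (+-suc x n)) ⟨
  suc n * k + Φ (x + suc n)                   ∎
  where open ≤-Reasoning

columnSum : (Vertex → ℕ) → ℕ → ℕ
columnSum g c = g (1 , c) + g (2 , c) + g (3 , c)

columnSum-distrib-+ : ∀ g h c → columnSum (λ v → g v + h v) c ≡ columnSum g c + columnSum h c
columnSum-distrib-+ g h c = regroup (g (1 , c)) (g (2 , c)) (g (3 , c)) (h (1 , c)) (h (2 , c)) (h (3 , c))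
  where
  regroup : ∀ a b c d e f → a + d + (b + e) + (c + f) ≡ a + b + c + (d + e + f)
  regroup = solve-∀

columnSum-δ : ∀ {a b} → 1 ≤ a → a ≤ 3 → ∀ c → columnSum (δ (a , b)) c ≡ bit (b ≡ᵇ c)
columnSum-δ {1} _ _ c = trans (+-identityʳ _) (+-identityʳ _)
columnSum-δ {2} _ _ c = +-identityʳ _
columnSum-δ {3} _ _ c = refl
columnSum-δ {suc (suc (suc (suc _)))} _ (s≤s (s≤s (s≤s ()))) c

sumFrom-degree : ∀ {m M} → All (IsEdge 3 m) M → sumFrom (columnSum (degree M)) 1 m ≡ 2 * length M
sumFrom-degree {m} [] = sumFrom-0 1 m
sumFrom-degree {m} {(x , y) ∷ M} ((x∈G , y∈G , _) ∷ edges) = begin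
  sumFrom (columnSum (degree ((x , y) ∷ M))) 1 m
    ≡⟨ sumFrom-cong split 1 m ⟩
  sumFrom (λ c → columnSum (δ x) c + columnSum (δ y) c + columnSum (degree M) c) 1 m
    ≡⟨ trans (sumFrom-distrib-+ _ _ 1 m)
             (cong (_+ sumFrom (columnSum (degree M)) 1 m) (sumFrom-distrib-+ _ _ 1 m)) ⟩
  sumFrom (columnSum (δ x)) 1 m + sumFrom (columnSum (δ y)) 1 m + sumFrom (columnSum (degree M)) 1 m
    ≡⟨ cong₂ _+_ (cong₂ _+_ (once x∈G) (once y∈G)) (sumFrom-degree edges) ⟩
  2 + 2 * length M
    ≡⟨ *-distribˡ-+ 2 1 (length M) ⟨
  2 * length ((x , y) ∷ M) ∎
  where
  open ≡-Reasoning
  split : ∀ c → columnSum (degree ((x , y) ∷ M)) c ≡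
                columnSum (δ x) c + columnSum (δ y) c + columnSum (degree M) c
  split c = trans (columnSum-distrib-+ (λ v → δ x v + δ y v) (degree M) c)
                  (cong (_+ columnSum (degree M) c) (columnSum-distrib-+ (δ x) (δ y) c))
  once : ∀ {v} → InGrid 3 m v → sumFrom (columnSum (δ v)) 1 m ≡ 1
  once ((1≤a , a≤3) , (1≤b , b≤m)) =
    trans (sumFrom-cong (columnSum-δ 1≤a a≤3) 1 m) (sumFrom-indicator-in 1 m 1≤b (s≤s b≤m))

module ThreeRowMatching {m M} (edges : All (IsEdge 3 m) M) (apart : AllPairs Apart M) where

  open Matching edges apart

  covered-outside : ∀ {v} → ¬ InGrid 3 m v → covered M v ≡ false
  covered-outside {v} ∉grid with covered M v in cov
  ... | true  = ⊥-elim (∉grid (covered⇒InGrid (subst T (sym cov) _)))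
  ... | false = refl

  column-outside : ∀ {c} → ¬ (1 ≤ c × c ≤ m) → column M c ≡ empty
  column-outside ∉range = cong₂ _,_ (outside _) (cong₂ _,_ (outside _) (outside _))
    where outside = λ r → covered-outside {r , _} (∉range ∘ proj₂)

  consistent-columns : ∀ c → Consistent (column M c) (column M (suc c)) (column M (suc (suc c)))
  consistent-columns c = top , one-covered-neighbour , bottom
    where
    outside-row : ∀ {r} → ¬ (1 ≤ r × r ≤ 3) → covered M (r , suc c) ≡ false
    outside-row ∉rows = covered-outside (∉rows ∘ proj₁)
    top = subst (λ z → T (covered M (1 , suc c)) →
                       ExactlyOne (covered M (1 , c) ∷ covered M (1 , suc (suc c)) ∷ z ∷ covered M (2 , suc c) ∷ []))
                (outside-row λ { (() , _) }) one-covered-neighbour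
    bottom = subst (λ z → T (covered M (3 , suc c)) →
                          ExactlyOne (covered M (3 , c) ∷ covered M (3 , suc (suc c)) ∷ covered M (2 , suc c) ∷ z ∷ []))
                   (outside-row λ { (_ , s≤s (s≤s (s≤s ()))) }) one-covered-neighbour

  degree≤covered : ∀ v → degree M v ≤ bit (covered M v)
  degree≤covered v with degree M v | degree≤1 v
  ... | zero  | _       = z≤n
  ... | suc _ | s≤s z≤n = ≤-refl

  2*length≤covered : 2 * length M ≤ sumFrom (size ∘ column M) 1 m
  2*length≤covered = subst (_≤ sumFrom (size ∘ column M) 1 m) (sumFrom-degree edges)
    (sumFrom-mono (λ c → +-mono-≤ (+-mono-≤ (degree≤covered (1 , c)) (degree≤covered (2 , c)))
                                  (degree≤covered (3 , c))) 1 m)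

  HasV12⇒pinned : ∀ {t} → HasV12 M t → T (pinned (column M t))
  HasV12⇒pinned (inj₁ e∈M) =
    Equivalence.from T-∧ (endpoint⇒covered e∈M (inj₁ refl) , endpoint⇒covered e∈M (inj₂ refl))
  HasV12⇒pinned (inj₂ e∈M) =
    Equivalence.from T-∧ (endpoint⇒covered e∈M (inj₂ refl) , endpoint⇒covered e∈M (inj₁ refl))

-- Consistent column sequences

module ConsistentSequence (p : ℕ → Column) (consistent : ∀ i → Consistent (p i) (p (suc i)) (p (suc (suc i))))
  where

  weight : ℕ → ℕ
  weight i = 2 * size (p i)

  Φ Φ⁻ : ℕ → ℕ
  Φ  i = potential (p i) (p (suc i))
  Φ⁻ i = potential (p (suc i)) (p i)

  consistent⁻ : ∀ i → Consistent (p (suc (suc i))) (p (suc i)) (p i)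
  consistent⁻ i = consistent-reverse (p i) (p (suc i)) (p (suc (suc i))) (consistent i)

  Φ-pinned : ∀ {i} → T (pinned (p (suc i))) → Φ i ≡ 2
  Φ-pinned {i} = potential-pinned (p i) (p (suc i)) (p (suc (suc i))) (consistent i)

  Φ⁻-pinned : ∀ {i} → T (pinned (p (suc i))) → Φ⁻ (suc i) ≡ 2
  Φ⁻-pinned {i} = potential-pinned (p (suc (suc i))) (p (suc i)) (p i) (consistent⁻ i)

  Φ-step : ∀ i → weight (suc i) + Φ (suc i) ≤ 3 + Φ i
  Φ-step i = potential-step (p i) (p (suc i)) (p (suc (suc i))) (consistent i)

  Φ⁻-step : ∀ i → weight (suc i) + Φ⁻ i ≤ 3 + Φ⁻ (suc i)
  Φ⁻-step i = potential-step (p (suc (suc i))) (p (suc i)) (p i) (consistent⁻ i)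

  weight-before-pinned : ∀ x n → Φ x ≤ 2 → T (pinned (p (suc (x + n)))) → sumFrom weight (suc x) n ≤ n * 3
  weight-before-pinned x n entry exit = +-cancelʳ-≤ 2 _ _ (begin
    sumFrom weight (suc x) n + 2         ≡⟨ cong (sumFrom weight (suc x) n +_) (Φ-pinned exit) ⟨
    sumFrom weight (suc x) n + Φ (x + n) ≤⟨ telescope Φ-step x n ⟩
    n * 3 + Φ x                          ≤⟨ +-monoʳ-≤ (n * 3) entry ⟩
    n * 3 + 2                            ∎)
    where open ≤-Reasoning

  weight-after-pinned : ∀ x n → T (pinned (p (suc x))) → Φ⁻ (suc x + n) ≤ 2 →
                        sumFrom weight (suc (suc x)) n ≤ n * 3
  weight-after-pinned x n entry exit = +-cancelʳ-≤ 2 _ _ (begin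
    sumFrom weight (suc (suc x)) n + 2          ≡⟨ cong (sumFrom weight (suc (suc x)) n +_) (Φ⁻-pinned entry) ⟨
    sumFrom weight (suc (suc x)) n + Φ⁻ (suc x) ≤⟨ telescope⁻ Φ⁻-step (suc x) n ⟩
    n * 3 + Φ⁻ (suc x + n)                      ≤⟨ +-monoʳ-≤ (n * 3) exit ⟩
    n * 3 + 2                                   ∎)
    where open ≤-Reasoning

  weight-pinned-pair : ∀ x → T (pinned (p (suc x))) → T (pinned (p (suc x + 3))) → sumFrom weight (suc x) 3 ≤ 8
  weight-pinned-pair x pin pin′ =
    +-mono-≤ (*-monoʳ-≤ 2 (size-pinned (p x) (p (suc x)) (p (2 + x)) (consistent x) pin))
    (+-mono-≤ (*-monoʳ-≤ 2 (size-after-pinned (p x) (p (suc x)) (p (2 + x)) (consistent x) pin))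
    (+-mono-≤ (*-monoʳ-≤ 2 (size-after-pinned (p (5 + x)) (p (4 + x)) (p (3 + x)) (consistent⁻ (3 + x))
                                              (subst (λ y → T (pinned (p (suc y)))) (+-comm x 3) pin′)))
    z≤n))

  weight-pinned-pair-then-gap : ∀ x n → T (pinned (p (suc x))) → T (pinned (p (suc x + 3))) →
                                T (pinned (p (suc x + (3 + n)))) → sumFrom weight (suc x) (3 + n) < (3 + n) * 3
  weight-pinned-pair-then-gap x n pin pin′ pin″ = s≤s (begin
    sumFrom weight (suc x) (3 + n)                           ≡⟨ sumFrom-split weight (suc x) 3 n ⟩
    sumFrom weight (suc x) 3 + sumFrom weight (suc x + 3) n ≤⟨ +-mono-≤ (weight-pinned-pair x pin pin′) gap ⟩
    8 + n * 3                                               ∎)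
    where
    open ≤-Reasoning
    gap = weight-before-pinned (x + 3) n (≤-reflexive (Φ-pinned pin′))
            (subst (λ y → T (pinned (p (suc y)))) (sym (+-assoc x 3 n)) pin″)

  weight-pinned-to-end : ∀ x n → T (pinned (p (suc x))) → p (suc (suc x + n)) ≡ empty →
                         sumFrom weight (suc x) (suc n) ≤ 1 + suc n * 3
  weight-pinned-to-end x n pin empty-after =
    +-mono-≤ (*-monoʳ-≤ 2 (size-pinned (p x) (p (suc x)) (p (2 + x)) (consistent x) pin))
             (weight-after-pinned x n pin
               (potential-empty (p (suc (suc x + n))) (p (suc x + n)) (p (x + n))
                                (consistent⁻ (x + n)) empty-after))

  weight-pinned-pair-then-end : ∀ x n → T (pinned (p (suc x))) → T (pinned (p (suc x + 3))) →
                                p (suc (suc x + (3 + n))) ≡ empty →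
                                sumFrom weight (suc x) (3 + suc n) ≤ (3 + suc n) * 3
  weight-pinned-pair-then-end x n pin pin′ empty-after = begin
    sumFrom weight (suc x) (3 + suc n)                             ≡⟨ sumFrom-split weight (suc x) 3 (suc n) ⟩
    sumFrom weight (suc x) 3 + sumFrom weight (suc x + 3) (suc n) ≤⟨ +-mono-≤ (weight-pinned-pair x pin pin′) end ⟩
    8 + (1 + suc n * 3)                                           ∎
    where
    open ≤-Reasoning
    end = weight-pinned-to-end (x + 3) n pin′
            (subst (λ y → p (suc (suc y)) ≡ empty) (sym (+-assoc x 3 n)) empty-after)

  weight-with-pinned-pairs : ∀ a b c d →
    let j = suc a ; k = j + (3 + b) ; l = k + (3 + c) ; m = l + (3 + d) in
    p 0 ≡ empty → p (suc m) ≡ empty →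
    T (pinned (p j)) → T (pinned (p (j + 3))) → T (pinned (p k)) → T (pinned (p (k + 3))) →
    T (pinned (p l)) → T (pinned (p (l + 3))) →
    2 + sumFrom weight 1 m ≤ m * 3
  weight-with-pinned-pairs a b c d empty-before empty-after pj pj′ pk pk′ pl pl′ = begin
    2 + sumFrom weight 1 (suc a + (3 + b) + (3 + c) + (3 + d))
      ≡⟨ cong (λ n → 2 + sumFrom weight 1 n) (+-suc (a + (3 + b) + (3 + c)) (3 + d)) ⟨
    2 + sumFrom weight 1 (a + (3 + b) + (3 + c) + (3 + suc d))
      ≡⟨ cong (2 +_) split ⟩
    2 + (W₁ + W₂ + W₃ + W₄)
      ≡⟨ shuffle W₁ W₂ W₃ W₄ ⟩
    W₁ + suc W₂ + suc W₃ + W₄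
      ≤⟨ +-mono-≤ (+-mono-≤ (+-mono-≤ before gap₁) gap₂) end ⟩
    a * 3 + (3 + b) * 3 + (3 + c) * 3 + (3 + suc d) * 3
      ≡⟨ collect a b c d ⟩
    (suc a + (3 + b) + (3 + c) + (3 + d)) * 3 ∎
    where
    open ≤-Reasoning
    W₁ = sumFrom weight 1 a
    W₂ = sumFrom weight (suc a) (3 + b)
    W₃ = sumFrom weight (suc a + (3 + b)) (3 + c)
    W₄ = sumFrom weight (suc a + (3 + b) + (3 + c)) (3 + suc d)
    split : sumFrom weight 1 (a + (3 + b) + (3 + c) + (3 + suc d)) ≡ W₁ + W₂ + W₃ + W₄
    split = trans (sumFrom-split weight 1 (a + (3 + b) + (3 + c)) (3 + suc d))
                  (cong (_+ W₄) (trans (sumFrom-split weight 1 (a + (3 + b)) (3 + c))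
                                       (cong (_+ W₃) (sumFrom-split weight 1 a (3 + b)))))
    shuffle : ∀ w₁ w₂ w₃ w₄ → 2 + (w₁ + w₂ + w₃ + w₄) ≡ w₁ + suc w₂ + suc w₃ + w₄
    shuffle = solve-∀
    collect : ∀ a b c d →
              a * 3 + (3 + b) * 3 + (3 + c) * 3 + (3 + suc d) * 3 ≡ (suc a + (3 + b) + (3 + c) + (3 + d)) * 3
    collect = solve-∀
    before = weight-before-pinned 0 a (potential-empty (p 0) (p 1) (p 2) (consistent 0) empty-before) pj
    gap₁ = weight-pinned-pair-then-gap a b pj pj′ pk
    gap₂ = weight-pinned-pair-then-gap (a + (3 + b)) c pk pk′ pl
    end = weight-pinned-pair-then-end (a + (3 + b) + (3 + c)) d pl pl′ empty-after

m+3≤n⇒∃[o]n≡m+[3+o] : ∀ m {n} → m + 3 ≤ n → ∃[ o ] n ≡ m + (3 + o)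
m+3≤n⇒∃[o]n≡m+[3+o] m m+3≤n with m≤n⇒∃[o]m+o≡n m+3≤n
... | o , refl = o , +-assoc m 3 o

length-bound-with-pinned-pairs : ∀ {m j k l M} → 1 ≤ j → j + 3 ≤ k → k + 3 ≤ l → l + 3 ≤ m →
  IsInducedMatching 3 m M →
  HasV12 M j → HasV12 M (j + 3) → HasV12 M k → HasV12 M (k + 3) → HasV12 M l → HasV12 M (l + 3) →
  2 + 4 * length M ≤ m * 3
length-bound-with-pinned-pairs {j = suc a} {k} {l} {M} _ j+3≤k k+3≤l l+3≤m induced hj hj′ hk hk′ hl hl′
  with m+3≤n⇒∃[o]n≡m+[3+o] (suc a) j+3≤k
     | m+3≤n⇒∃[o]n≡m+[3+o] k k+3≤l
     | m+3≤n⇒∃[o]n≡m+[3+o] l l+3≤m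
... | b , refl | c , refl | d , refl = begin
  2 + 4 * length M                      ≡⟨ cong (2 +_) (*-assoc 2 2 (length M)) ⟩
  2 + 2 * (2 * length M)                ≤⟨ +-monoʳ-≤ 2 (*-monoʳ-≤ 2 2*length≤covered) ⟩
  2 + 2 * sumFrom (size ∘ column M) 1 m ≡⟨ cong (2 +_) (sumFrom-distribˡ-* 2 (size ∘ column M) 1 m) ⟨
  2 + sumFrom weight 1 m                ≤⟨ weight-with-pinned-pairs a b c d
                                             (column-outside λ { (() , _) }) (column-outside (1+n≰n ∘ proj₂))
                                             (pin hj) (pin hj′) (pin hk) (pin hk′) (pin hl) (pin hl′) ⟩
  m * 3                                 ∎
  where
  open ≤-Reasoning
  m = suc a + (3 + b) + (3 + c) + (3 + d)
  open ThreeRowMatching (induced⇒edges {M = M} induced) (induced⇒apart {M = M} induced)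
    renaming (HasV12⇒pinned to pin)
  open ConsistentSequence (column M) consistent-columns

-- A staggered induced matching of G₃,₄q₊₃ with 3q + 2 edges

hEdge : ℕ → ℕ → Edge
hEdge r c = (r , c) , (r , suc c)

hEdge-in-grid : ∀ {m r c} → 1 ≤ r → r ≤ 3 → 1 ≤ c → suc c ≤ m → IsEdge 3 m (hEdge r c)
hEdge-in-grid 1≤r r≤3 1≤c c<m =
  ((1≤r , r≤3) , (1≤c , ≤-trans (n≤1+n _) c<m)) , ((1≤r , r≤3) , (s≤s z≤n , c<m)) ,
  inj₂ (refl , inj₁ refl)

hEdge-far-columns : ∀ {r c r′ c′} → 3 + c ≤ c′ → Apart (hEdge r c) (hEdge r′ c′)
hEdge-far-columns {c′ = c′} far = Apart-intro λ where
  (inj₁ refl) (inj₁ refl) t → 1+n≰n (≤-trans far (≤-trans (Touch-column t) (n≤1+n _)))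
  (inj₁ refl) (inj₂ refl) t → 1+n≰n (≤-trans far (≤-trans (n≤1+n c′) (≤-trans (Touch-column t) (n≤1+n _))))
  (inj₂ refl) (inj₁ refl) t → 1+n≰n (≤-trans far (Touch-column t))
  (inj₂ refl) (inj₂ refl) t → 1+n≰n (≤-trans far (≤-trans (n≤1+n c′) (Touch-column t)))

hEdge-far-rows : ∀ {r c r′ c′} → 2 + r ≤ r′ → Apart (hEdge r c) (hEdge r′ c′)
hEdge-far-rows far = Apart-intro λ where
  (inj₁ refl) (inj₁ refl) t → 1+n≰n (≤-trans far (Touch-row t))
  (inj₁ refl) (inj₂ refl) t → 1+n≰n (≤-trans far (Touch-row t))
  (inj₂ refl) (inj₁ refl) t → 1+n≰n (≤-trans far (Touch-row t))
  (inj₂ refl) (inj₂ refl) t → 1+n≰n (≤-trans far (Touch-row t))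

hEdge-disjoint-columns : ∀ {r c r′ c′} → r ≢ r′ → c ≢ c′ → suc c ≢ c′ → c ≢ suc c′ →
                         Apart (hEdge r c) (hEdge r′ c′)
hEdge-disjoint-columns r≢r′ c≢c′ c+1≢c′ c≢c′+1 = Apart-intro λ where
  (inj₁ refl) (inj₁ refl) t → c≢c′ (Touch-across-rows r≢r′ t)
  (inj₁ refl) (inj₂ refl) t → c≢c′+1 (Touch-across-rows r≢r′ t)
  (inj₂ refl) (inj₁ refl) t → c+1≢c′ (Touch-across-rows r≢r′ t)
  (inj₂ refl) (inj₂ refl) t → c≢c′ (suc-injective (Touch-across-rows r≢r′ t))

≢-mod-4 : ∀ {s t} i j → s % 4 ≢ t % 4 → s + i * 4 ≢ t + j * 4
≢-mod-4 {s} {t} i j s≢t eq =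
  s≢t (trans (sym ([m+kn]%n≡m%n s i 4)) (trans (cong (_% 4) eq) ([m+kn]%n≡m%n t j 4)))

stripe : ℕ → ℕ → ℕ → List Edge
stripe r s n = applyUpTo (λ i → hEdge r (s + i * 4)) n

-- Rows 1 and 3 use columns ≡ 1, 2 (mod 4), row 2 uses columns ≡ 3, 0 (mod 4).
staggered : ℕ → List Edge
staggered q = stripe 1 1 (suc q) ++ stripe 2 3 q ++ stripe 3 1 (suc q)

length-stripe : ∀ r s n → length (stripe r s n) ≡ n
length-stripe r s n = length-applyUpTo (λ i → hEdge r (s + i * 4)) n

length-staggered : ∀ q → length (staggered q) ≡ 2 + 3 * q
length-staggered q = begin
  length (staggered q)
    ≡⟨ length-++ (stripe 1 1 (suc q)) ⟩
  length (stripe 1 1 (suc q)) + length (stripe 2 3 q ++ stripe 3 1 (suc q))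
    ≡⟨ cong (length (stripe 1 1 (suc q)) +_) (length-++ (stripe 2 3 q)) ⟩
  length (stripe 1 1 (suc q)) + (length (stripe 2 3 q) + length (stripe 3 1 (suc q)))
    ≡⟨ cong₂ _+_ (length-stripe 1 1 (suc q)) (cong₂ _+_ (length-stripe 2 3 q) (length-stripe 3 1 (suc q))) ⟩
  suc q + (q + suc q)
    ≡⟨ count q ⟩
  2 + 3 * q ∎
  where
  open ≡-Reasoning
  count : ∀ q → suc q + (q + suc q) ≡ 2 + 3 * q
  count = solve-∀

stripe-apart : ∀ r s n → AllPairs Apart (stripe r s n)
stripe-apart r s n = AllPairs.applyUpTo⁺₁ (λ i → hEdge r (s + i * 4)) n λ {i} i<j _ →
  hEdge-far-columns (≤-trans (≤-trans (n≤1+n _) (≤-reflexive (x∙yz≈y∙xz 4 s (i * 4))))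
                             (+-monoʳ-≤ s (*-monoˡ-≤ 4 i<j)))

stripes-apart : ∀ r s n r′ s′ n′ → (∀ i j → Apart (hEdge r (s + i * 4)) (hEdge r′ (s′ + j * 4))) →
                All (λ e → All (Apart e) (stripe r′ s′ n′)) (stripe r s n)
stripes-apart r s n r′ s′ n′ apart =
  All.applyUpTo⁺₂ _ n λ i → All.applyUpTo⁺₂ (λ j → hEdge r′ (s′ + j * 4)) n′ λ j → apart i j

staggered-apart : ∀ q → AllPairs Apart (staggered q)
staggered-apart q =
  AllPairs.++⁺ (stripe-apart 1 1 (suc q))
    (AllPairs.++⁺ (stripe-apart 2 3 q) (stripe-apart 3 1 (suc q)) (stripes-apart 2 3 q 3 1 (suc q) λ i j →
       hEdge-disjoint-columns (λ ()) (≢-mod-4 i j λ ()) (≢-mod-4 i j λ ()) (≢-mod-4 i j λ ())))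
    (All.zipWith (uncurry All.++⁺)
      ( stripes-apart 1 1 (suc q) 2 3 q (λ i j →
          hEdge-disjoint-columns (λ ()) (≢-mod-4 i j λ ()) (≢-mod-4 i j λ ()) (≢-mod-4 i j λ ()))
      , stripes-apart 1 1 (suc q) 3 1 (suc q) (λ _ _ → hEdge-far-rows ≤-refl)))

staggered-edges : ∀ q → All (IsEdge 3 (3 + q * 4)) (staggered q)
staggered-edges q = All.++⁺ (outer 1 (s≤s z≤n) (s≤s z≤n)) (All.++⁺ middle (outer 3 (s≤s z≤n) ≤-refl))
  where
  outer : ∀ r → 1 ≤ r → r ≤ 3 → All (IsEdge 3 (3 + q * 4)) (stripe r 1 (suc q))
  outer r 1≤r r≤3 = All.applyUpTo⁺₁ _ (suc q) λ i<1+q →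
    hEdge-in-grid 1≤r r≤3 (s≤s z≤n) (≤-trans (+-monoʳ-≤ 2 (*-monoˡ-≤ 4 (≤-pred i<1+q))) (n≤1+n _))
  middle : All (IsEdge 3 (3 + q * 4)) (stripe 2 3 q)
  middle = All.applyUpTo⁺₁ _ q λ i<q →
    hEdge-in-grid (s≤s z≤n) (s≤s (s≤s z≤n)) (s≤s z≤n) (≤-trans (*-monoˡ-≤ 4 i<q) (m≤n+m _ 3))

staggered-induced : ∀ q → IsInducedMatching 3 (3 + q * 4) (staggered q)
staggered-induced q = edges+apart⇒induced (staggered-edges q) (staggered-apart q)

lemma3p16 : (m j k l : ℕ) → m % 4 ≡ 3 →
    1 ≤ j → j + 3 ≤ k → k + 3 ≤ l → l + 3 ≤ m →
    (M : List Edge) → IsInducedMatching 3 m M →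
    HasV12 M j → HasV12 M (j + 3) →
    HasV12 M k → HasV12 M (k + 3) →
    HasV12 M l → HasV12 M (l + 3) →
    ¬ IsMaximumInducedMatching 3 m M
lemma3p16 m j k l m%4≡3 1≤j j+3≤k k+3≤l l+3≤m M induced hj hj′ hk hk′ hl hl′ (_ , maximum) = 1+n≰n (begin
  suc ((3 + q * 4) * 3)        ≡⟨ arithmetic q ⟩
  2 + 4 * (2 + 3 * q)          ≡⟨ cong (λ n → 2 + 4 * n) (length-staggered q) ⟨
  2 + 4 * length (staggered q) ≤⟨ +-monoʳ-≤ 2 (*-monoʳ-≤ 4 (maximum (staggered q) staggered-in-G)) ⟩
  2 + 4 * length M             ≤⟨ length-bound-with-pinned-pairs 1≤j j+3≤k k+3≤l l+3≤m induced hj hj′ hk hk′ hl hl′ ⟩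
  m * 3                        ≡⟨ cong (_* 3) m≡3+q*4 ⟩
  (3 + q * 4) * 3              ∎)
  where
  open ≤-Reasoning
  q = m / 4
  m≡3+q*4 : m ≡ 3 + q * 4
  m≡3+q*4 = trans (m≡m%n+[m/n]*n m 4) (cong (_+ q * 4) m%4≡3)
  staggered-in-G : IsInducedMatching 3 m (staggered q)
  staggered-in-G = subst (λ n → IsInducedMatching 3 n (staggered q)) (sym m≡3+q*4) (staggered-induced q)
  arithmetic : ∀ q → suc ((3 + q * 4) * 3) ≡ 2 + 4 * (2 + 3 * q)
  arithmetic = solve-∀
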